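{- Let $k$ be a positive integer such that $\sqrt k$ is an integer, let $t\in\{k-1,k\}$, and let $\mathcal G^\times$ be a family of $t$-element subsets of $[n]$ with $\tau(\mathcal G^\times)\ge\sqrt k$. If $\mathcal F$ is a family of $k$-element subsets of $[n]$ such that $\mathcal F$ and $\mathcal G^\times$ are cross-intersecting, then $\mathcal F$ can be set-covered by a family $\mathcal H$ of at most $k^{\sqrt k}$ sets, each of size $\sqrt k$.
   Context: Families $\mathcal A,\mathcal B$ are cross-intersecting if $A\cap B\ne\emptyset$ for all $A\in\mathcal A$, $B\in\mathcal B$. The covering number $\tau(\mathcal G)$ is the smallest size of a set $C$ with $C\cap G\ne\emptyset$ for all $G\in\mathcal G$. A family $\mathcal H$ set-covers a family $\mathcal F$ if for each $F\in\mathcal F$ there is $H\in\mathcal H$ with $H\subset F$. -}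

module Defs where

open import Data.Nat using (ℕ; _≤_)
open import Data.Fin.Subset using (Subset; _∩_; _⊆_; Nonempty; ∣_∣)
open import Data.List using (List)
open import Data.List.Membership.Propositional using (_∈_)
open import Data.List.Relation.Unary.Any using (Any)
open import Relation.Binary.PropositionalEquality using (_≡_)

Family : ℕ → Set
Family n = List (Subset n)

Uniform : ∀ {n} → ℕ → Family n → Set
Uniform t 𝒢 = ∀ {G} → G ∈ 𝒢 → ∣ G ∣ ≡ t

CrossIntersecting : ∀ {n} → Family n → Family n → Set
CrossIntersecting 𝒜 ℬ = ∀ {A B} → A ∈ 𝒜 → B ∈ ℬ → Nonempty (A ∩ B)

IsCover : ∀ {n} → Subset n → Family n → Set
IsCover C 𝒢 = ∀ {G} → G ∈ 𝒢 → Nonempty (C ∩ G)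

CoveringNumber≥ : ∀ {n} → Family n → ℕ → Set
CoveringNumber≥ {n} 𝒢 s = ∀ (C : Subset n) → IsCover C 𝒢 → s ≤ ∣ C ∣

SetCovers : ∀ {n} → Family n → Family n → Set
SetCovers ℋ ℱ = ∀ {F} → F ∈ ℱ → Any (λ H → H ⊆ F) ℋ

{-# OPTIONS --safe #-}
module Submission where

-- Grow a tree of partial transversals from ∅. A node S with ∣S∣ < s is not a cover
-- since τ(𝒢) ≥ s, so some G ∈ 𝒢 misses S, and S branches into S ∪ {x} for the at
-- most k points x ∈ G. After s rounds there are at most k^s leaves, each of size s.
-- Any F ∈ ℱ meets every such G, so choosing x ∈ F ∩ G at each step follows a path
-- of subsets of F down to a leaf.

open import Defs
open import Data.Nat using (ℕ; _≤_; _*_; _^_; _∸_)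
open import Data.Fin.Subset using (∣_∣)
open import Data.List using (length)
open import Data.List.Relation.Unary.All using (All)
open import Data.Sum using (_⊎_)
open import Data.Product using (Σ-syntax; _×_)
open import Relation.Binary.PropositionalEquality using (_≡_)

open import Data.Nat using (zero; suc; _+_; _<_; z≤n; s≤s)
open import Data.Nat.Properties using (+-mono-≤; *-monoˡ-≤; +-suc; +-identityʳ; m∸n≤m; ≤-refl; ≤-trans; m≤n+m; <⇒≱)
open import Data.Fin using (Fin; zero; suc)
open import Data.Fin.Subset using (Subset; _∩_; _∪_; _⊆_; ⁅_⁆; ⊥; Empty; inside; outside)
  renaming (_∈_ to _∈ₛ_; _∉_ to _∉ₛ_)
open import Data.Fin.Subset.Properties
  using (nonempty?; ∪-identityˡ; x∈⁅y⁆⇒x≡y; x∈p∪q⁻; x∈p∩q⁺; x∈p∩q⁻; drop-not-there; ∣⊥∣≡0; ⊥⊆)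
open import Data.Vec using ([]; _∷_; here; there)
open import Data.List using (List; []; _∷_; map; concatMap)
open import Data.List.Properties using (length-map; length-++)
open import Data.List.Membership.Propositional using (_∈_; find; lose)
open import Data.List.Membership.Propositional.Properties using (∈-map⁺; ∈-map⁻)
open import Data.List.Relation.Unary.Any using (Any; here; there; any?)
import Data.List.Relation.Unary.Any.Properties as Any
import Data.List.Relation.Unary.All as All
import Data.List.Relation.Unary.All.Properties as All
open import Data.Sum using (inj₁; inj₂; [_,_])
open import Data.Product using (∃-syntax; _,_)
open import Function using (_∘_)
open import Relation.Binary.PropositionalEquality using (refl; sym; trans; cong; subst; module ≡-Reasoning)
open import Relation.Nullary using (yes; no; ¬?; contradiction)
open import Relation.Nullary.Decidable using (decidable-stable)

private
  variable
    n : ℕ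
    A B : Set

length-concatMap≤ : ∀ {m} (f : A → List B) (xs : List A) →
                    (∀ {x} → x ∈ xs → length (f x) ≤ m) →
                    length (concatMap f xs) ≤ length xs * m
length-concatMap≤ f []       _   = z≤n
length-concatMap≤ f (x ∷ xs) f≤m = subst (_≤ _) (sym (length-++ (f x)))
  (+-mono-≤ (f≤m (here refl)) (length-concatMap≤ f xs (f≤m ∘ there)))

elements : Subset n → List (Fin n)
elements []            = []
elements (inside  ∷ p) = zero ∷ map suc (elements p)
elements (outside ∷ p) = map suc (elements p)

length-elements : (p : Subset n) → length (elements p) ≡ ∣ p ∣
length-elements []            = refl
length-elements (inside  ∷ p) = cong suc (trans (length-map suc (elements p)) (length-elements p))
length-elements (outside ∷ p) = trans (length-map suc (elements p)) (length-elements p)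

∈-elements⁺ : ∀ {x} (p : Subset n) → x ∈ₛ p → x ∈ elements p
∈-elements⁺ (inside  ∷ p) here        = here refl
∈-elements⁺ (inside  ∷ p) (there x∈p) = there (∈-map⁺ suc (∈-elements⁺ p x∈p))
∈-elements⁺ (outside ∷ p) (there x∈p) = ∈-map⁺ suc (∈-elements⁺ p x∈p)

∈-elements⁻ : ∀ {x} (p : Subset n) → x ∈ elements p → x ∈ₛ p
∈-elements⁻ (inside  ∷ p) (here refl) = here
∈-elements⁻ (inside  ∷ p) (there x∈)  with ∈-map⁻ suc x∈
... | _ , y∈ , refl = there (∈-elements⁻ p y∈)
∈-elements⁻ (outside ∷ p) x∈          with ∈-map⁻ suc x∈
... | _ , y∈ , refl = there (∈-elements⁻ p y∈)

∣⁅x⁆∪p∣≡1+∣p∣ : ∀ {x : Fin n} {p} → x ∉ₛ p → ∣ ⁅ x ⁆ ∪ p ∣ ≡ suc ∣ p ∣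
∣⁅x⁆∪p∣≡1+∣p∣ {x = zero}  {inside  ∷ p} x∉p = contradiction here x∉p
∣⁅x⁆∪p∣≡1+∣p∣ {x = zero}  {outside ∷ p} _   = cong (suc ∘ ∣_∣) (∪-identityˡ p)
∣⁅x⁆∪p∣≡1+∣p∣ {x = suc x} {inside  ∷ p} x∉p = cong suc (∣⁅x⁆∪p∣≡1+∣p∣ (drop-not-there x∉p))
∣⁅x⁆∪p∣≡1+∣p∣ {x = suc x} {outside ∷ p} x∉p = ∣⁅x⁆∪p∣≡1+∣p∣ (drop-not-there x∉p)

⁅x⁆∪p⊆q : ∀ {x : Fin n} {p q} → x ∈ₛ q → p ⊆ q → ⁅ x ⁆ ∪ p ⊆ q
⁅x⁆∪p⊆q {x = x} {p} {q} x∈q p⊆q y∈ =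
  [ (λ y∈⁅x⁆ → subst (_∈ₛ q) (sym (x∈⁅y⁆⇒x≡y x y∈⁅x⁆)) x∈q) , p⊆q ] (x∈p∪q⁻ ⁅ x ⁆ p y∈)

disjoint⇒∉ : ∀ {x : Fin n} {p q} → Empty (p ∩ q) → x ∈ₛ q → x ∉ₛ p
disjoint⇒∉ p∩q=∅ x∈q x∈p = p∩q=∅ (_ , x∈p∩q⁺ (x∈p , x∈q))

isCover⊎avoided : (S : Subset n) (𝒢 : Family n) →
                  IsCover S 𝒢 ⊎ ∃[ G ] (G ∈ 𝒢 × Empty (S ∩ G))
isCover⊎avoided S 𝒢 with any? (λ G → ¬? (nonempty? (S ∩ G))) 𝒢
... | yes avoided  = inj₂ (find avoided)
... | no ¬avoided  = inj₁ λ G∈𝒢 → decidable-stable (nonempty? _) (¬avoided ∘ lose G∈𝒢)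

module Branching (𝒢 : Family n) where

  leaves : ℕ → Subset n → Family n
  leaves zero    S = S ∷ []
  leaves (suc d) S with isCover⊎avoided S 𝒢
  ... | inj₁ _       = []  -- unreachable from ∅ within s rounds, as τ(𝒢) ≥ s
  ... | inj₂ (G , _) = concatMap (λ x → leaves d (⁅ x ⁆ ∪ S)) (elements G)

  leaves-size : ∀ d S → All (λ H → ∣ H ∣ ≡ d + ∣ S ∣) (leaves d S)
  leaves-size zero    S = refl All.∷ All.[]
  leaves-size (suc d) S with isCover⊎avoided S 𝒢
  ... | inj₁ _                = All.[]
  ... | inj₂ (G , _ , S∩G=∅) = All.concat⁺ (All.map⁺ (All.tabulate grow))
    where
    grow : ∀ {x} → x ∈ elements G → All (λ H → ∣ H ∣ ≡ suc d + ∣ S ∣) (leaves d (⁅ x ⁆ ∪ S))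
    grow {x} x∈ = All.map (λ {H} ∣H∣≡ → begin
        ∣ H ∣               ≡⟨ ∣H∣≡ ⟩
        d + ∣ ⁅ x ⁆ ∪ S ∣   ≡⟨ cong (d +_) (∣⁅x⁆∪p∣≡1+∣p∣ (disjoint⇒∉ S∩G=∅ (∈-elements⁻ G x∈))) ⟩
        d + suc ∣ S ∣       ≡⟨ +-suc d ∣ S ∣ ⟩
        suc d + ∣ S ∣       ∎)
      (leaves-size d (⁅ x ⁆ ∪ S))
      where open ≡-Reasoning

  length-leaves≤ : ∀ {k} → (∀ {G} → G ∈ 𝒢 → ∣ G ∣ ≤ k) → ∀ d S → length (leaves d S) ≤ k ^ d
  length-leaves≤ ∣𝒢∣≤k zero    S = ≤-refl
  length-leaves≤ {k} ∣𝒢∣≤k (suc d) S with isCover⊎avoided S 𝒢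
  ... | inj₁ _             = z≤n
  ... | inj₂ (G , G∈𝒢 , _) = ≤-trans
    (length-concatMap≤ _ (elements G) (λ {x} _ → length-leaves≤ ∣𝒢∣≤k d (⁅ x ⁆ ∪ S)))
    (*-monoˡ-≤ (k ^ d) (subst (_≤ k) (sym (length-elements G)) (∣𝒢∣≤k G∈𝒢)))

  leaves-set-cover : ∀ {s ℱ} → CoveringNumber≥ 𝒢 s → CrossIntersecting ℱ 𝒢 →
                     ∀ d S → d + ∣ S ∣ ≡ s → ∀ {F} → F ∈ ℱ → S ⊆ F → Any (_⊆ F) (leaves d S)
  leaves-set-cover τ≥s ℱ×𝒢 zero    S _ _ S⊆F = here S⊆F
  leaves-set-cover {s} τ≥s ℱ×𝒢 (suc d) S d+∣S∣≡s {F} F∈ℱ S⊆F with isCover⊎avoided S 𝒢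
  ... | inj₁ S-covers = contradiction (τ≥s S S-covers)
    (<⇒≱ (subst (∣ S ∣ <_) d+∣S∣≡s (s≤s (m≤n+m ∣ S ∣ d))))
  ... | inj₂ (G , G∈𝒢 , S∩G=∅) with ℱ×𝒢 F∈ℱ G∈𝒢
  ...   | x , x∈F∩G with x∈p∩q⁻ F G x∈F∩G
  ...     | x∈F , x∈G = Any.concatMap⁺ (λ y → leaves d (⁅ y ⁆ ∪ S))
    (lose (∈-elements⁺ G x∈G) (leaves-set-cover τ≥s ℱ×𝒢 d (⁅ x ⁆ ∪ S) d+∣x∪S∣≡s F∈ℱ (⁅x⁆∪p⊆q x∈F S⊆F)))
    where
    d+∣x∪S∣≡s : d + ∣ ⁅ x ⁆ ∪ S ∣ ≡ s
    d+∣x∪S∣≡s = trans (cong (d +_) (∣⁅x⁆∪p∣≡1+∣p∣ (disjoint⇒∉ S∩G=∅ x∈G)))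
                      (trans (+-suc d ∣ S ∣) d+∣S∣≡s)

  cross-intersecting⇒small-set-cover :
    ∀ {k s} → (∀ {G} → G ∈ 𝒢 → ∣ G ∣ ≤ k) → CoveringNumber≥ 𝒢 s →
    ∀ {ℱ} → CrossIntersecting ℱ 𝒢 →
    Σ[ ℋ ∈ Family n ] (length ℋ ≤ k ^ s × All (λ H → ∣ H ∣ ≡ s) ℋ × SetCovers ℋ ℱ)
  cross-intersecting⇒small-set-cover {s = s} ∣𝒢∣≤k τ≥s ℱ×𝒢 =
    leaves s ⊥ ,
    length-leaves≤ ∣𝒢∣≤k s ⊥ ,
    All.map (λ ∣H∣≡ → trans ∣H∣≡ s+∣⊥∣≡s) (leaves-size s ⊥) ,
    λ F∈ℱ → leaves-set-cover τ≥s ℱ×𝒢 s ⊥ s+∣⊥∣≡s F∈ℱ ⊥⊆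
    where
    s+∣⊥∣≡s : s + ∣ ⊥ {n} ∣ ≡ s
    s+∣⊥∣≡s = trans (cong (s +_) (∣⊥∣≡0 n)) (+-identityʳ s)

open Branching using (cross-intersecting⇒small-set-cover)

lemma1 : (n k s t : ℕ) → 1 ≤ k → k ≡ s * s → (t ≡ k ∸ 1 ⊎ t ≡ k)
    → (𝒢 : Family n) → Uniform t 𝒢 → CoveringNumber≥ 𝒢 s
    → (ℱ : Family n) → Uniform k ℱ → CrossIntersecting ℱ 𝒢
    → Σ[ ℋ ∈ Family n ] (length ℋ ≤ k ^ s × All (λ H → ∣ H ∣ ≡ s) ℋ × SetCovers ℋ ℱ)
lemma1 n k s t _ _ t≡k∸1⊎t≡k 𝒢 ∣𝒢∣≡t τ≥s ℱ _ ℱ×𝒢 =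
  cross-intersecting⇒small-set-cover 𝒢 (λ G∈𝒢 → subst (_≤ k) (sym (∣𝒢∣≡t G∈𝒢)) t≤k) τ≥s ℱ×𝒢
  where
  t≤k : t ≤ k
  t≤k = [ (λ { refl → m∸n≤m k 1 }) , (λ { refl → ≤-refl }) ] t≡k∸1⊎t≡k
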